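{- Let $G'=(\mathcal{A}\cup\mathcal{P},E')$ be a bipartite graph with $n$ vertices in which every vertex of $\mathcal{A}$ has degree exactly $2$. Consider the following iterative procedure. While some vertex of $\mathcal{P}$ has degree $1$, perform one round: consider all maximal paths $(v_1,\dots,v_k)$ consisting of vertices of degree $2$, with $v_0$ and $v_{k+1}$ the (non-degree-2) vertices obtained by extending the path at either end; for every such path in which $v_0$ (or, symmetrically, $v_{k+1}$, choosing one end arbitrarily if both qualify) has degree $1$, simultaneously add to the matching every edge of the path $(v_0,v_1,\dots,v_{k+1})$ at even distance from $v_0$ (the edge $(v_0,v_1)$ having distance $0$) and delete the vertices $v_0,\dots,v_k$ together with their incident edges. Then the number of rounds performed is $O(\log n)$.
   Context: This loop is the first phase of the paper's parallel algorithm for finding an applicant-complete matching (a matching covering every vertex of $\mathcal{A}$) in such a graph. In the graph, "degree" refers to the current graph after previous deletions. -}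

module Defs where

open import Data.Nat using (ℕ; zero; suc; _≤_)
open import Data.Bool using (Bool; true; false; _∧_)
open import Data.Fin using (Fin; zero; suc; inject₁; fromℕ)
open import Data.List using (List; length; filter; allFin)
open import Data.Product using (Σ; _×_; ∃; ∃-syntax)
open import Data.Sum using (_⊎_)
open import Relation.Nullary using (¬_)
open import Relation.Binary.PropositionalEquality using (_≡_; _≢_)
open import Function.Definitions using (Injective)
open import Function.Bundles using (_⇔_)
open import Level using (0ℓ) renaming (suc to lsuc)

-- A state of the procedure: the set of vertices not yet deleted
-- (the current graph is the subgraph induced on the alive vertices;
-- vertices are only ever deleted together with their incident edges).
State : ℕ → Set
State n = Fin n → Bool

degIn : {n : ℕ} → (Fin n → Fin n → Bool) → State n → Fin n → ℕ
degIn {n} adj alive v = length (filter (λ u → alive u ∧ adj v u ≡? true) (allFin n))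
  where
  open import Data.Bool.Properties using () renaming (_≟_ to _≡?_)

allAlive : {n : ℕ} → State n
allAlive _ = true

-- A finite simple bipartite graph on vertex set Fin n = 𝒜 ∪ 𝒫.
-- side v ≡ true means v ∈ 𝒜, side v ≡ false means v ∈ 𝒫.
-- Every vertex of 𝒜 has degree exactly 2 (in the initial graph).
record Graph (n : ℕ) : Set where
  field
    side   : Fin n → Bool
    adj    : Fin n → Fin n → Bool
    adjSym : ∀ u v → adj u v ≡ adj v u
    bipartite : ∀ u v → adj u v ≡ true → side u ≢ side v
    degA   : ∀ v → side v ≡ true → degIn adj allAlive v ≡ 2

module _ {n : ℕ} (G : Graph n) where
  open Graph G

  deg : State n → Fin n → ℕ
  deg = degIn adj

  Edge : State n → Fin n → Fin n → Set
  Edge s u v = s u ≡ true × s v ≡ true × adj u v ≡ true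

  -- A maximal path (v₀, v₁, …, v_k, v_{k+1}), k ≥ 1, given as
  -- p : Fin (k+2) → Fin n, of distinct vertices of the current graph,
  -- consecutive vertices adjacent, the inner vertices v₁..v_k of degree 2,
  -- and the extension vertices v₀, v_{k+1} of degree ≠ 2.
  -- (Here the argument k' is k - 1, so k = suc k'.)
  record MaxPath (s : State n) (k' : ℕ) (p : Fin (suc (suc (suc k'))) → Fin n) : Set where
    field
      distinct : Injective _≡_ _≡_ p
      edges    : ∀ (i : Fin (suc (suc k'))) → Edge s (p (inject₁ i)) (p (suc i))
      inner    : ∀ (i : Fin (suc k')) → deg s (p (suc (inject₁ i))) ≡ 2
      startEnd : deg s (p zero) ≢ 2
      finalEnd : deg s (p (fromℕ (suc (suc k')))) ≢ 2

  first : ∀ {k'} → (Fin (suc (suc (suc k'))) → Fin n) → Fin n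
  first p = p zero

  final : ∀ {k'} → (Fin (suc (suc (suc k'))) → Fin n) → Fin n
  final {k'} p = p (fromℕ (suc (suc k')))

  LoopCond : State n → Set
  LoopCond s = ∃[ v ] (s v ≡ true × side v ≡ false × deg s v ≡ 1)

  -- T is the set of chosen ends v₀:
  -- each chosen vertex is an end of degree 1 of a maximal path; for every
  -- maximal path with an end of degree 1, exactly one of its ends is chosen
  -- (an arbitrary one if both qualify).  Then for every maximal path
  -- starting at a chosen end v₀, the vertices v₀,…,v_k are deleted
  -- (simultaneously); nothing else is deleted.
  record RoundWith (s s' : State n) (T : Fin n → Set) : Set where
    field
      chosenOk  : ∀ v → T v → s v ≡ true × deg s v ≡ 1 ×
                    ∃[ k' ] ∃[ p ] (MaxPath s k' p × first p ≡ v)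
      covered   : ∀ k' p → MaxPath s k' p →
                    (deg s (first p) ≡ 1 ⊎ deg s (final {k'} p) ≡ 1) →
                    ((deg s (first p) ≡ 1 × T (first p)) ⊎ (deg s (final {k'} p) ≡ 1 × T (final {k'} p)))
                    × ¬ (T (first p) × T (final {k'} p))
      newState  : ∀ u → (s' u ≡ true) ⇔
                    (s u ≡ true ×
                      ¬ (∃[ v ] (T v × ∃[ k' ] ∃[ p ] (MaxPath s k' p × first p ≡ v ×
                           ∃[ i ] (p (inject₁ {suc (suc k')} i) ≡ u)))))

  Round : State n → State n → Set₁
  Round s s' = Σ (Fin n → Set) (RoundWith s s')

  -- Runs s k : a sequence of k rounds performed from state s, each one
  -- performed only while the loop condition holds.  (Stopping early is
  -- allowed, so bounding all k covers every (prefix of an) execution.)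
  data Runs : State n → ℕ → Set₁ where
    stop : ∀ s → Runs s 0
    step : ∀ {s s' k} → LoopCond s → Round s s' → Runs s' k → Runs s (suc k)

module Submission where

-- Potential: the number of leaves (alive vertices of degree 1).  Throughout
-- the loop every alive vertex of 𝒜 keeps degree 2, so leaves lie in 𝒫 and
-- every leaf starts a maximal path of degree-2 vertices; this path is unique.
-- In one round a surviving vertex of degree 2 loses no neighbour (a lost
-- neighbour would make it the end of a deleted maximal path, and ends have
-- degree ≠ 2) and a surviving old leaf stops being a leaf.  Hence a leaf y
-- after the round had degree ≥ 3 and lost at least two neighbours, each the
-- last deleted vertex of a path coming from a chosen leaf and ending at y.
-- Mapping old leaves to the end of their path, every new leaf receives two
-- old leaves, so double counting halves the number of leaves per round.
-- Since there are at most n leaves and at least one while the loop runs,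
-- there are at most 1 + ⌊log₂ n⌋ rounds.

open import Defs

open import Data.Nat using (ℕ; zero; suc; _≡ᵇ_; _+_; _∸_; _*_; _^_; _≤_; _<_; z≤n; s≤s; s≤s⁻¹; z<s)
open import Data.Nat.Properties
open import Data.Nat.Logarithm using (⌊log₂_⌋; ⌊log₂⌋-mono-≤; ⌊log₂[2^n]⌋≡n)
open import Data.Bool using (Bool; true; false; _∧_; not)
open import Data.Bool.Properties using (T-≡) renaming (_≟_ to _≟B_)
open import Data.Fin as F using (Fin; toℕ; fromℕ; fromℕ<; inject₁)
import Data.Fin.Properties as FP
open import Data.List using (List; []; _∷_; length; filter; allFin)
open import Data.List.Properties using (filter-all; length-filter; length-tabulate)
open import Data.List.Membership.Propositional using (_∈_; _∉_)
open import Data.List.Membership.Propositional.Properties using (∈-filter⁻; ∈-allFin)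
open import Data.List.Relation.Unary.Any using (here; there)
open import Data.List.Relation.Unary.All as All using (All; []; _∷_)
open import Data.List.Relation.Unary.All.Properties using (¬Any⇒All¬)
open import Data.List.Relation.Unary.Unique.Propositional using (Unique; []; _∷_)
import Data.List.Relation.Unary.Unique.Propositional.Properties as Unique
open import Data.Product using (_×_; _,_; proj₁; proj₂; ∃-syntax)
open import Data.Sum using (_⊎_; inj₁; inj₂)
open import Data.Empty using (⊥; ⊥-elim)
open import Function using (id)
open import Function.Bundles using (Equivalence)
open import Level using (0ℓ)
open import Relation.Nullary using (¬_; yes; no; ¬?)
open import Relation.Nullary.Negation using (¬¬-Monad)
open import Relation.Nullary.Decidable using (decidable-stable)
open import Relation.Binary.Definitions using (DecidableEquality; tri<; tri≈; tri>)
open import Relation.Binary.PropositionalEquality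

module Counting {A : Set} where

  -- The number of entries of xs passing the Boolean test q.  Defs.degIn
  -- counts neighbours in exactly this form.
  count : (A → Bool) → List A → ℕ
  count q xs = length (filter (λ x → q x ≟B true) xs)

  count-mono : ∀ {q r : A → Bool} → (∀ x → q x ≡ true → r x ≡ true) →
               ∀ xs → count q xs ≤ count r xs
  count-mono h [] = z≤n
  count-mono {q} {r} h (x ∷ xs) with q x in qx | r x in rx
  ... | true  | true  = s≤s (count-mono h xs)
  ... | true  | false with () ← trans (sym (h x qx)) rx
  ... | false | true  = m≤n⇒m≤1+n (count-mono h xs)
  ... | false | false = count-mono h xs

  count-≤-+ : ∀ {q r t : A → Bool} → (∀ x → r x ≡ true → q x ≡ true ⊎ t x ≡ true) →
              ∀ xs → count r xs ≤ count q xs + count t xs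
  count-≤-+ h [] = z≤n
  count-≤-+ {q} {r} {t} h (x ∷ xs) with ih ← count-≤-+ h xs | r x in rx | q x in qx | t x in tx
  ... | false | false | false = ih
  ... | false | false | true  = ≤-trans ih (+-monoʳ-≤ (count q xs) (n≤1+n _))
  ... | false | true  | false = m≤n⇒m≤1+n ih
  ... | false | true  | true  = ≤-trans ih (+-mono-≤ (n≤1+n _) (n≤1+n _))
  ... | true  | true  | false = s≤s ih
  ... | true  | true  | true  = s≤s (≤-trans ih (+-monoʳ-≤ (count q xs) (n≤1+n _)))
  ... | true  | false | true  = ≤-trans (s≤s ih) (≤-reflexive (sym (+-suc _ _)))
  ... | true  | false | false with h x rx
  ...   | inj₁ e with () ← trans (sym e) qx
  ...   | inj₂ e with () ← trans (sym e) tx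

  count-witness : ∀ {q} xs → 1 ≤ count q xs → ∃[ x ] (x ∈ xs × q x ≡ true)
  count-witness {q} (x ∷ xs) h with q x in qx
  ... | true  = x , here refl , qx
  ... | false with y , y∈xs , qy ← count-witness xs h = y , there y∈xs , qy

  count-two-witnesses : ∀ {q} xs → Unique xs → 2 ≤ count q xs →
                        ∃[ x ] ∃[ y ] (x ≢ y × q x ≡ true × q y ≡ true)
  count-two-witnesses {q} (x ∷ xs) (x∉xs ∷ u) h with q x in qx
  ... | true with y , y∈xs , qy ← count-witness xs (s≤s⁻¹ h) = x , y , All.lookup x∉xs y∈xs , qx , qy
  ... | false = count-two-witnesses xs u h

  module _ (_≟_ : DecidableEquality A) where

    remove : A → List A → List A
    remove x = filter (λ z → ¬? (z ≟ x))

    remove-absent : ∀ {x} zs → x ∉ zs → remove x zs ≡ zs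
    remove-absent {x} zs x∉zs =
      filter-all (λ z → ¬? (z ≟ x)) (All.map (λ x≢z z≡x → x≢z (sym z≡x)) (¬Any⇒All¬ zs x∉zs))

    remove-unique : ∀ x zs → Unique zs → length zs ≤ suc (length (remove x zs))
    remove-unique x [] _ = z≤n
    remove-unique x (z ∷ zs) (z∉zs ∷ u) with z ≟ x
    ... | yes refl = s≤s (≤-reflexive (cong length (sym (remove-absent zs (λ m → All.lookup z∉zs m refl)))))
    ... | no _     = s≤s (remove-unique x zs u)

    remove-⊆ : ∀ {x xs zs} → (∀ {z} → z ∈ zs → z ∈ x ∷ xs) → ∀ {z} → z ∈ remove x zs → z ∈ xs
    remove-⊆ {x} zs⊆ z∈ with z∈zs , z≢x ← ∈-filter⁻ (λ z → ¬? (z ≟ x)) z∈ with zs⊆ z∈zs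
    ... | here z≡x   = ⊥-elim (z≢x z≡x)
    ... | there z∈xs = z∈xs

    unique-≤-count : ∀ {q} xs zs → Unique zs → (∀ {z} → z ∈ zs → z ∈ xs) →
                     (∀ {z} → z ∈ zs → q z ≡ true) → length zs ≤ count q xs
    unique-≤-count [] [] _ _ _ = z≤n
    unique-≤-count [] (z ∷ zs) _ zs⊆xs _ with () ← zs⊆xs (here refl)
    unique-≤-count {q} (x ∷ xs) zs u zs⊆xs qzs
      with rest ← unique-≤-count xs (remove x zs) (Unique.filter⁺ _ u) (remove-⊆ zs⊆xs)
                    (λ m → qzs (proj₁ (∈-filter⁻ _ m)))
         | q x in qx
    ... | true  = ≤-trans (remove-unique x zs u) (s≤s rest)
    ... | false = subst (_≤ count q xs) (cong length (remove-absent zs x∉zs)) rest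
      where
      x∉zs : x ∉ zs
      x∉zs x∈zs with () ← trans (sym (qzs x∈zs)) qx

    module DoubleCounting (q : A → Bool) (R : A → A → Set)
                          (functional : ∀ {y y′ x} → R y x → R y′ x → y ≡ y′) where

      TwoWitnesses : A → Set
      TwoWitnesses y = ∃[ x₁ ] ∃[ x₂ ] (x₁ ≢ x₂ × R y x₁ × R y x₂ × q x₁ ≡ true × q x₂ ≡ true)

      witnesses : ∀ {ys} → All TwoWitnesses ys → List A
      witnesses [] = []
      witnesses ((x₁ , x₂ , _) ∷ ws) = x₁ ∷ x₂ ∷ witnesses ws

      witnesses-length : ∀ {ys} (ws : All TwoWitnesses ys) → length (witnesses ws) ≡ length ys + length ys
      witnesses-length [] = refl
      witnesses-length {_ ∷ ys} (_ ∷ ws) =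
        cong suc (trans (cong suc (witnesses-length ws)) (sym (+-suc (length ys) (length ys))))

      witness-source : ∀ {ys} (ws : All TwoWitnesses ys) {x} → x ∈ witnesses ws →
                       ∃[ y ] (y ∈ ys × R y x × q x ≡ true)
      witness-source ((_ , _ , _ , r₁ , _ , q₁ , _) ∷ _) (here refl) = _ , here refl , r₁ , q₁
      witness-source ((_ , _ , _ , _ , r₂ , _ , q₂) ∷ _) (there (here refl)) = _ , here refl , r₂ , q₂
      witness-source (_ ∷ ws) (there (there x∈)) with y , y∈ , r , qx ← witness-source ws x∈ =
        y , there y∈ , r , qx

      witnesses-unique : ∀ {ys} → Unique ys → (ws : All TwoWitnesses ys) → Unique (witnesses ws)
      witnesses-unique [] [] = []
      witnesses-unique {y ∷ ys} (y∉ys ∷ u) ((_ , _ , x₁≢x₂ , r₁ , r₂ , _) ∷ ws) =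
        (x₁≢x₂ ∷ All.tabulate (fresh r₁)) ∷ All.tabulate (fresh r₂) ∷ witnesses-unique u ws
        where
        fresh : ∀ {x} → R y x → ∀ {z} → z ∈ witnesses ws → x ≢ z
        fresh r z∈ refl with y′ , y′∈ys , r′ , _ ← witness-source ws z∈ =
          All.lookup y∉ys y′∈ys (functional r r′)

      double-count : ∀ {ys} → Unique ys → All TwoWitnesses ys →
                     ∀ xs → (∀ x → x ∈ xs) → length ys + length ys ≤ count q xs
      double-count u ws xs complete = subst (_≤ count q xs) (witnesses-length ws)
        (unique-≤-count xs (witnesses ws) (witnesses-unique u ws) (λ _ → complete _)
                        (λ z∈ → proj₂ (proj₂ (proj₂ (witness-source ws z∈)))))


∧-trueˡ : ∀ {a b} → a ∧ b ≡ true → a ≡ true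
∧-trueˡ {true} _ = refl

∧-trueʳ : ∀ {a b} → a ∧ b ≡ true → b ≡ true
∧-trueʳ {true} e = e

∧-intro : ∀ {a b} → a ≡ true → b ≡ true → a ∧ b ≡ true
∧-intro refl refl = refl

false≢true : false ≢ true
false≢true ()

module Neighbourhood {n : ℕ} (G : Graph n) where
  open Graph G
  open Counting {Fin n}

  nb : State n → Fin n → Fin n → Bool
  nb s v u = s u ∧ adj v u

  no-loop : ∀ v → adj v v ≢ true
  no-loop v e = bipartite v v e refl

  nb-intro : ∀ {s v u} → s u ≡ true → adj v u ≡ true → nb s v u ≡ true
  nb-intro = ∧-intro

  nb-flip : ∀ {s v u} → s v ≡ true → nb s v u ≡ true → nb s u v ≡ true
  nb-flip {s} {v} {u} sv vu = nb-intro {s} sv (trans (adjSym u v) (∧-trueʳ {s u} vu))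

  neighbours-≤-deg : ∀ {s v} zs → Unique zs → (∀ {z} → z ∈ zs → nb s v z ≡ true) → length zs ≤ deg G s v
  neighbours-≤-deg zs u nbs = unique-≤-count F._≟_ (allFin n) zs u (λ _ → ∈-allFin _) nbs

  deg1-unique : ∀ {s v a b} → deg G s v ≡ 1 → nb s v a ≡ true → nb s v b ≡ true → a ≡ b
  deg1-unique {s} {v} {a} {b} d va vb with a F.≟ b
  ... | yes a≡b = a≡b
  ... | no a≢b =
    ⊥-elim (1+n≰n (≤-trans (neighbours-≤-deg {s} {v} (a ∷ b ∷ []) ((a≢b ∷ []) ∷ [] ∷ []) nbs) (≤-reflexive d)))
    where
    nbs : ∀ {z} → z ∈ a ∷ b ∷ [] → nb s v z ≡ true
    nbs (here refl) = va
    nbs (there (here refl)) = vb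

  deg2-other : ∀ {s v a b c} → deg G s v ≡ 2 → a ≢ b → nb s v a ≡ true → nb s v b ≡ true →
               nb s v c ≡ true → c ≡ a ⊎ c ≡ b
  deg2-other {s} {v} {a} {b} {c} d a≢b va vb vc with c F.≟ a | c F.≟ b
  ... | yes c≡a | _       = inj₁ c≡a
  ... | no _    | yes c≡b = inj₂ c≡b
  ... | no c≢a  | no c≢b =
    ⊥-elim (1+n≰n (≤-trans (neighbours-≤-deg {s} {v} (a ∷ b ∷ c ∷ []) u nbs) (≤-reflexive d)))
    where
    u : Unique (a ∷ b ∷ c ∷ [])
    u = (a≢b ∷ (λ e → c≢a (sym e)) ∷ []) ∷ ((λ e → c≢b (sym e)) ∷ []) ∷ [] ∷ []
    nbs : ∀ {z} → z ∈ a ∷ b ∷ c ∷ [] → nb s v z ≡ true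
    nbs (here refl) = va
    nbs (there (here refl)) = vb
    nbs (there (there (here refl))) = vc

  some-neighbour : ∀ {s v} → 1 ≤ deg G s v → ∃[ u ] (nb s v u ≡ true)
  some-neighbour h with u , _ , vu ← count-witness (allFin n) h = u , vu

  two-neighbours : ∀ {s v} → 2 ≤ deg G s v → ∃[ a ] ∃[ b ] (a ≢ b × nb s v a ≡ true × nb s v b ≡ true)
  two-neighbours h = count-two-witnesses (allFin n) (Unique.allFin⁺ n) h

-- clamp K i is the index i as an element of Fin (suc K) (truncated at K);
-- it turns a Fin-indexed path into an ℕ-indexed one.
clamp : (K : ℕ) → ℕ → Fin (suc K)
clamp zero    _       = F.zero
clamp (suc K) zero    = F.zero
clamp (suc K) (suc i) = F.suc (clamp K i)

clamp-toℕ : ∀ K i → i ≤ K → toℕ (clamp K i) ≡ i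
clamp-toℕ zero    zero    _       = refl
clamp-toℕ (suc K) zero    _       = refl
clamp-toℕ (suc K) (suc i) (s≤s h) = cong suc (clamp-toℕ K i h)

clamp-toℕ-inverse : ∀ K (x : Fin (suc K)) → clamp K (toℕ x) ≡ x
clamp-toℕ-inverse zero    F.zero    = refl
clamp-toℕ-inverse (suc K) F.zero    = refl
clamp-toℕ-inverse (suc K) (F.suc x) = cong F.suc (clamp-toℕ-inverse K x)

clamp-top : ∀ K → clamp K K ≡ fromℕ K
clamp-top zero    = refl
clamp-top (suc K) = cong F.suc (clamp-top K)

extendAt : {A : Set} → (ℕ → A) → ℕ → A → ℕ → A
extendAt f m c i with i ≟ m
... | yes _ = c
... | no _  = f i

extendAt-new : ∀ {A : Set} (f : ℕ → A) m c → extendAt f m c m ≡ c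
extendAt-new f m c with m ≟ m
... | yes _   = refl
... | no m≢m  = ⊥-elim (m≢m refl)

extendAt-old : ∀ {A : Set} (f : ℕ → A) m c i → i ≢ m → extendAt f m c i ≡ f i
extendAt-old f m c i i≢m with i ≟ m
... | yes i≡m = ⊥-elim (i≢m i≡m)
... | no _    = refl

module Paths {n : ℕ} (G : Graph n) where
  open Graph G
  open Neighbourhood G

  record MaxPathℕ (s : State n) (k : ℕ) (f : ℕ → Fin n) : Set where
    field
      injective : ∀ i j → i ≤ suc (suc k) → j ≤ suc (suc k) → f i ≡ f j → i ≡ j
      adjacent  : ∀ i → i < suc (suc k) → adj (f i) (f (suc i)) ≡ true
      alive     : ∀ i → i ≤ suc (suc k) → s (f i) ≡ true
      inner     : ∀ i → i < suc k → deg G s (f (suc i)) ≡ 2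
      startEnd  : deg G s (f 0) ≢ 2
      finalEnd  : deg G s (f (suc (suc k))) ≢ 2

  module _ {s k f} (P : MaxPathℕ s k f) where
    open MaxPathℕ P

    next-nb : ∀ i → i < suc (suc k) → nb s (f i) (f (suc i)) ≡ true
    next-nb i h = nb-intro {s} (alive (suc i) h) (adjacent i h)

    prev-nb : ∀ i → i < suc (suc k) → nb s (f (suc i)) (f i) ≡ true
    prev-nb i h = nb-flip {s} (alive i (<⇒≤ h)) (next-nb i h)

    skip-distinct : ∀ i → suc (suc i) ≤ suc (suc k) → f i ≢ f (suc (suc i))
    skip-distinct i h e with () ← injective i (suc (suc i)) (≤-trans (n≤1+n _) (≤-trans (n≤1+n _) h)) h e

  fromMaxPath : ∀ {s k p} → MaxPath G s k p → MaxPathℕ s k (λ i → p (clamp (suc (suc k)) i))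
  fromMaxPath {s} {k} {p} mp = record
    { injective = λ i j hi hj e → trans (sym (clamp-toℕ K i hi))
                                    (trans (cong toℕ (MaxPath.distinct mp e)) (clamp-toℕ K j hj))
    ; adjacent  = λ i h → proj₂ (proj₂ (edge i h))
    ; alive     = alive′
    ; inner     = inner′
    ; startEnd  = MaxPath.startEnd mp
    ; finalEnd  = subst (λ x → deg G s (p x) ≢ 2) (sym (clamp-top K)) (MaxPath.finalEnd mp)
    }
    where
    K = suc (suc k)
    f : ℕ → Fin n
    f i = p (clamp K i)
    reindex : ∀ x → p x ≡ f (toℕ x)
    reindex x = cong p (sym (clamp-toℕ-inverse K x))
    edge : ∀ i → i < K → Edge G s (f i) (f (suc i))
    edge i h = subst₂ (Edge G s)
      (trans (reindex _) (cong f (trans (FP.toℕ-inject₁ (fromℕ< h)) (FP.toℕ-fromℕ< h))))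
      (trans (reindex _) (cong (λ j → f (suc j)) (FP.toℕ-fromℕ< h)))
      (MaxPath.edges mp (fromℕ< h))
    alive′ : ∀ i → i ≤ K → s (f i) ≡ true
    alive′ i h with m≤n⇒m<n∨m≡n h
    ... | inj₁ i<K  = proj₁ (edge i i<K)
    ... | inj₂ refl = proj₁ (proj₂ (edge (suc k) ≤-refl))
    inner′ : ∀ i → i < suc k → deg G s (f (suc i)) ≡ 2
    inner′ i h = subst (λ v → deg G s v ≡ 2)
      (trans (reindex _) (cong (λ j → f (suc j)) (trans (FP.toℕ-inject₁ (fromℕ< h)) (FP.toℕ-fromℕ< h))))
      (MaxPath.inner mp (fromℕ< h))

  toMaxPath : ∀ {s k f} → MaxPathℕ s k f → MaxPath G s k (λ x → f (toℕ x))
  toMaxPath {s} {k} {f} P = record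
    { distinct = λ {x} {y} e → FP.toℕ-injective (injective _ _ (FP.toℕ≤pred[n] x) (FP.toℕ≤pred[n] y) e)
    ; edges    = λ i → subst (λ v → Edge G s v (f (suc (toℕ i)))) (cong f (sym (FP.toℕ-inject₁ i)))
                         (alive _ (<⇒≤ (FP.toℕ<n i)) , alive _ (FP.toℕ<n i) , adjacent _ (FP.toℕ<n i))
    ; inner    = λ i → subst (λ v → deg G s (f (suc v)) ≡ 2) (sym (FP.toℕ-inject₁ i)) (inner _ (FP.toℕ<n i))
    ; startEnd = startEnd
    ; finalEnd = subst (λ v → deg G s (f v) ≢ 2) (sym (FP.toℕ-fromℕ (suc (suc k)))) finalEnd
    }
    where open MaxPathℕ P

  reverse : ∀ {s k f} → MaxPathℕ s k f → MaxPathℕ s k (λ i → f (suc (suc k) ∸ i))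
  reverse {s} {k} {f} P = record
    { injective = λ i j hi hj e → trans (sym (m∸[m∸n]≡n hi))
                    (trans (cong (K ∸_) (injective _ _ (m∸n≤m K i) (m∸n≤m K j) e)) (m∸[m∸n]≡n hj))
    ; adjacent  = adjacent′
    ; alive     = λ i _ → alive _ (m∸n≤m K i)
    ; inner     = inner′
    ; startEnd  = finalEnd
    ; finalEnd  = subst (λ v → deg G s (f v) ≢ 2) (sym (n∸n≡0 K)) startEnd
    }
    where
    open MaxPathℕ P
    K = suc (suc k)
    adjacent′ : ∀ i → i < K → adj (f (K ∸ i)) (f (K ∸ suc i)) ≡ true
    adjacent′ i (s≤s h) rewrite +-∸-assoc 1 h =
      trans (adjSym _ _) (adjacent _ (s≤s (m∸n≤m (suc k) i)))
    inner′ : ∀ i → i < suc k → deg G s (f (K ∸ suc i)) ≡ 2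
    inner′ i (s≤s h) rewrite +-∸-assoc 1 h = inner (k ∸ i) (s≤s (m∸n≤m k i))

  -- Two maximal paths leaving the same vertex of degree 1 coincide: the first
  -- step is forced by the degree 1, every further step by the degree 2 of the
  -- inner vertex reached, and the length by the end condition.
  module _ {s k₁ k₂ f g} (P : MaxPathℕ s k₁ f) (Q : MaxPathℕ s k₂ g)
           (same-start : f 0 ≡ g 0) (leaf : deg G s (f 0) ≡ 1) where

    private
      agree : ∀ i → suc i ≤ suc (suc k₁) → suc i ≤ suc (suc k₂) → f i ≡ g i × f (suc i) ≡ g (suc i)
      agree zero _ _ = same-start ,
        deg1-unique {s} leaf (next-nb P 0 z<s)
          (subst (λ v → nb s v (g 1) ≡ true) (sym same-start) (next-nb Q 0 z<s))
      agree (suc i) h₁ h₂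
        with fᵢ≡gᵢ , fᵢ₊₁≡gᵢ₊₁ ← agree i (m≤n⇒m≤1+n (s≤s⁻¹ h₁)) (m≤n⇒m≤1+n (s≤s⁻¹ h₂))
        with deg2-other {s} (MaxPathℕ.inner P i (s≤s⁻¹ h₁)) (skip-distinct P i h₁)
               (prev-nb P i (m≤n⇒m≤1+n (s≤s⁻¹ h₁))) (next-nb P (suc i) h₁)
               (subst (λ v → nb s v (g (suc (suc i))) ≡ true) (sym fᵢ₊₁≡gᵢ₊₁) (next-nb Q (suc i) h₂))
      ... | inj₁ gᵢ₊₂≡fᵢ = ⊥-elim (skip-distinct Q i h₂ (trans (sym fᵢ≡gᵢ) (sym gᵢ₊₂≡fᵢ)))
      ... | inj₂ gᵢ₊₂≡fᵢ₊₂ = fᵢ₊₁≡gᵢ₊₁ , sym gᵢ₊₂≡fᵢ₊₂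

    leaf-path-unique : k₁ ≡ k₂ × (∀ i → i ≤ suc (suc k₁) → f i ≡ g i)
    leaf-path-unique with <-cmp k₁ k₂
    ... | tri≈ _ refl _ = refl , λ { zero _ → same-start ; (suc i) h → proj₂ (agree i h h) }
    ... | tri< k₁<k₂ _ _ = ⊥-elim (MaxPathℕ.finalEnd P
          (trans (cong (deg G s) (proj₂ (agree (suc k₁) ≤-refl (s≤s (s≤s (<⇒≤ k₁<k₂))))))
                 (MaxPathℕ.inner Q (suc k₁) (s≤s k₁<k₂))))
    ... | tri> _ _ k₂<k₁ = ⊥-elim (MaxPathℕ.finalEnd Q
          (trans (cong (deg G s) (sym (proj₂ (agree (suc k₂) (s≤s (s≤s (<⇒≤ k₂<k₁))) ≤-refl))))
                 (MaxPathℕ.inner P (suc k₂) (s≤s k₂<k₁))))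

  record Walk (s : State n) (y : Fin n) (L : ℕ) (f : ℕ → Fin n) : Set where
    field
      injective : ∀ i j → i ≤ suc L → j ≤ suc L → f i ≡ f j → i ≡ j
      adjacent  : ∀ i → i < suc L → adj (f i) (f (suc i)) ≡ true
      alive     : ∀ i → i ≤ suc L → s (f i) ≡ true
      inner     : ∀ i → i < L → deg G s (f (suc i)) ≡ 2
      second    : deg G s (f 1) ≡ 2
      start     : f 0 ≡ y

  module _ {s y} (alive-y : s y ≡ true) (leaf : deg G s y ≡ 1) where

    walk-ends : ∀ {L f} → Walk s y L f → deg G s (f (suc L)) ≢ 2 → ∃[ k ] MaxPathℕ s k f
    walk-ends {zero}  W end = ⊥-elim (end (Walk.second W))
    walk-ends {suc k} W end = k , record
      { injective = injective ; adjacent = adjacent ; alive = alive ; inner = inner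
      ; startEnd  = λ d2 → <⇒≢ (n<1+n 1) (trans (sym leaf) (trans (cong (deg G s) (sym start)) d2))
      ; finalEnd  = end }
      where open Walk W

    walk-extends : ∀ {L f} → Walk s y L f → deg G s (f (suc L)) ≡ 2 →
                   ∃[ c ] Walk s y (suc L) (extendAt f (suc (suc L)) c)
    walk-extends {L} {f} W d = c , record
      { injective = injective′ ; adjacent = adjacent′ ; alive = alive′ ; inner = inner′
      ; second    = trans (cong (deg G s) (old 1 (s≤s z≤n))) second
      ; start     = trans (old 0 z≤n) start }
      where
      open Walk W
      next : ∃[ c ] (nb s (f (suc L)) c ≡ true × c ≢ f L)
      next with a , b , a≢b , va , vb ← two-neighbours {s} (≤-reflexive (sym d)) with f L F.≟ a
      ... | yes fL≡a = b , vb , λ b≡fL → a≢b (trans (sym fL≡a) (sym b≡fL))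
      ... | no fL≢a  = a , va , λ a≡fL → fL≢a (sym a≡fL)
      c = proj₁ next
      last-c = proj₁ (proj₂ next)
      f′ = extendAt f (suc (suc L)) c
      old : ∀ i → i ≤ suc L → f′ i ≡ f i
      old i h = extendAt-old f (suc (suc L)) c i (λ e → 1+n≰n (subst (_≤ suc L) e h))
      new : f′ (suc (suc L)) ≡ c
      new = extendAt-new f (suc (suc L)) c
      walk-nb : ∀ i → i < suc L → nb s (f i) (f (suc i)) ≡ true
      walk-nb i h = nb-intro {s} (alive (suc i) h) (adjacent i h)
      -- No f j with j < L is adjacent to f (L+1): f 0 = y has the single
      -- neighbour f 1, and an inner f j has only the neighbours f (j±1).
      not-adjacent-to-last : ∀ j → j < L → nb s (f j) (f (suc L)) ≡ true → ⊥
      not-adjacent-to-last zero 0<L adj-last =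
        <⇒≢ 0<L (sym (suc-injective (injective (suc L) 1 ≤-refl (s≤s z≤n)
          (deg1-unique {s} (trans (cong (deg G s) start) leaf) adj-last (walk-nb 0 z<s)))))
      not-adjacent-to-last (suc j) j+1<L adj-last
        with j+2≤ ← m≤n⇒m≤1+n j+1<L
        with j≤ ← ≤-trans (n≤1+n j) (≤-trans (n≤1+n _) j+2≤)
        with deg2-other {s} (inner j (<⇒≤ j+1<L))
               (λ e → <⇒≢ (s≤s (n≤1+n j)) (injective j _ j≤ j+2≤ e))
               (nb-flip {s} (alive j j≤) (walk-nb j (≤-trans (s≤s (n≤1+n j)) j+2≤)))
               (walk-nb (suc j) (s≤s (<⇒≤ j+1<L))) adj-last
      ... | inj₁ fL+1≡fj   = <⇒≢ (≤-trans (n≤1+n (suc j)) j+2≤) (sym (injective _ j ≤-refl j≤ fL+1≡fj))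
      ... | inj₂ fL+1≡fj+2 = <⇒≢ (s≤s j+1<L) (sym (injective _ _ ≤-refl (m≤n⇒m≤1+n j+1<L) fL+1≡fj+2))
      -- c is a new vertex: it is not the last vertex (no loops), not the
      -- previous one (by choice), and no earlier f j can be adjacent to f (L+1).
      fresh : ∀ j → j ≤ suc L → c ≢ f j
      fresh j h c≡fj with last-is-fj ← subst (λ v → nb s (f (suc L)) v ≡ true) c≡fj last-c
                         | m≤n⇒m<n∨m≡n h
      ... | inj₂ refl = no-loop (f (suc L)) (∧-trueʳ {s (f (suc L))} last-is-fj)
      ... | inj₁ (s≤s j≤L) with m≤n⇒m<n∨m≡n j≤L
      ...   | inj₂ refl = proj₂ (proj₂ next) c≡fj
      ...   | inj₁ j<L  = not-adjacent-to-last j j<L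
                            (nb-flip {s} (alive (suc L) ≤-refl) last-is-fj)
      injective′ : ∀ i j → i ≤ suc (suc L) → j ≤ suc (suc L) → f′ i ≡ f′ j → i ≡ j
      injective′ i j hi hj e with m≤n⇒m<n∨m≡n hi | m≤n⇒m<n∨m≡n hj
      ... | inj₁ (s≤s i≤) | inj₁ (s≤s j≤) = injective i j i≤ j≤ (trans (sym (old i i≤)) (trans e (old j j≤)))
      ... | inj₁ (s≤s i≤) | inj₂ refl = ⊥-elim (fresh i i≤ (trans (sym new) (trans (sym e) (old i i≤))))
      ... | inj₂ refl | inj₁ (s≤s j≤) = ⊥-elim (fresh j j≤ (trans (sym new) (trans e (old j j≤))))
      ... | inj₂ refl | inj₂ refl = refl
      adjacent′ : ∀ i → i < suc (suc L) → adj (f′ i) (f′ (suc i)) ≡ true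
      adjacent′ i (s≤s h) with m≤n⇒m<n∨m≡n h
      ... | inj₁ i<  = subst₂ (λ a b → adj a b ≡ true) (sym (old i h)) (sym (old (suc i) i<)) (adjacent i i<)
      ... | inj₂ refl = subst₂ (λ a b → adj a b ≡ true) (sym (old i h)) (sym new) (∧-trueʳ {s c} last-c)
      alive′ : ∀ i → i ≤ suc (suc L) → s (f′ i) ≡ true
      alive′ i h with m≤n⇒m<n∨m≡n h
      ... | inj₁ (s≤s i≤) = subst (λ v → s v ≡ true) (sym (old i i≤)) (alive i i≤)
      ... | inj₂ refl     = subst (λ v → s v ≡ true) (sym new) (∧-trueˡ last-c)
      inner′ : ∀ i → i < suc L → deg G s (f′ (suc i)) ≡ 2
      inner′ i (s≤s h) with m≤n⇒m<n∨m≡n h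
      ... | inj₁ i<L  = trans (cong (deg G s) (old (suc i) (s≤s h))) (inner i i<L)
      ... | inj₂ refl = trans (cong (deg G s) (old (suc i) (s≤s h))) d

    -- Extending a walk while its last vertex has degree 2 stops within n
    -- steps, because the vertices of a walk are distinct.
    walk-to-end : ∀ fuel L f → Walk s y L f → n ≤ fuel + suc L →
                  ∃[ k ] ∃[ g ] (MaxPathℕ s k g × g 0 ≡ y)
    walk-to-end zero L f W h with i , j , i<j , e ← FP.pigeonhole (s≤s h) (λ x → f (toℕ x)) =
      ⊥-elim (<⇒≢ i<j (Walk.injective W _ _ (FP.toℕ≤pred[n] i) (FP.toℕ≤pred[n] j) e))
    walk-to-end (suc fuel) L f W h with deg G s (f (suc L)) ≟ 2
    ... | no end with k , P ← walk-ends W end = k , f , P , Walk.start W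
    ... | yes d  with c , W′ ← walk-extends W d =
      walk-to-end fuel (suc L) _ W′ (≤-trans h (≤-reflexive (sym (+-suc fuel (suc L)))))

    leaf-path : ∀ a → nb s y a ≡ true → deg G s a ≡ 2 → ∃[ k ] ∃[ f ] (MaxPathℕ s k f × f 0 ≡ y)
    leaf-path a ya da = walk-to-end n 0 first-edge W₀ (m≤m+n n 1)
      where
      first-edge : ℕ → Fin n
      first-edge zero    = y
      first-edge (suc _) = a
      y≢a : y ≢ a
      y≢a refl = no-loop y (∧-trueʳ {s y} ya)
      W₀ : Walk s y 0 first-edge
      W₀ = record
        { injective = λ { zero zero _ _ _ → refl ; zero (suc zero) _ _ e → ⊥-elim (y≢a e)
                        ; (suc zero) zero _ _ e → ⊥-elim (y≢a (sym e)) ; (suc zero) (suc zero) _ _ _ → refl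
                        ; (suc (suc _)) _ (s≤s ()) _ _ ; _ (suc (suc _)) _ (s≤s ()) _ }
        ; adjacent  = λ { zero _ → ∧-trueʳ {s a} ya ; (suc _) (s≤s ()) }
        ; alive     = λ { zero _ → alive-y ; (suc _) _ → ∧-trueˡ ya }
        ; inner     = λ _ ()
        ; second    = da
        ; start     = refl }

module Round {n : ℕ} (G : Graph n) (s s′ : State n) (T : Fin n → Set) (R : RoundWith G s s′ T) where
  open Graph G using (adj)
  open Neighbourhood G
  open Paths G
  open RoundWith R
  open Equivalence

  survivor-alive : ∀ {u} → s′ u ≡ true → s u ≡ true
  survivor-alive {u} h = proj₁ (to (newState u) h)

  path-deleted : ∀ {k f} → MaxPathℕ s k f → T (f 0) → ∀ i → i < suc (suc k) → s′ (f i) ≢ true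
  path-deleted {k} {f} P chosen i h alive′ = proj₂ (to (newState (f i)) alive′)
    (f 0 , chosen , k , (λ x → f (toℕ x)) , toMaxPath P , refl , fromℕ< h ,
     cong f (trans (FP.toℕ-inject₁ _) (FP.toℕ-fromℕ< h)))

  DeletedInto : Fin n → Fin n → Set
  DeletedInto y z = ∃[ k ] ∃[ f ] (MaxPathℕ s k f × T (f 0) × f (suc (suc k)) ≡ y × f (suc k) ≡ z)

  module _ {y} (survives : s′ y ≡ true) where

    -- If a survivor y is adjacent to the vertex f j of a deleted path, then
    -- f j is the last deleted vertex and y the end of the path: the path's start
    -- has y as its only neighbour and inner vertices have only their two path
    -- neighbours, which are deleted unless one is the end.
    neighbour-on-path : ∀ {k f} (P : MaxPathℕ s k f) → T (f 0) → ∀ j → j < suc (suc k) →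
                        nb s (f j) y ≡ true → DeletedInto y (f j)
    neighbour-on-path P chosen zero _ fj-y =
      ⊥-elim (path-deleted P chosen 1 (s≤s (s≤s z≤n))
        (subst (λ v → s′ v ≡ true) (deg1-unique {s} leaf fj-y (next-nb P 0 z<s)) survives))
      where leaf = proj₁ (proj₂ (chosenOk _ chosen))
    neighbour-on-path {k} {f} P chosen (suc j) h fj-y
      with deg2-other {s} (MaxPathℕ.inner P j (s≤s⁻¹ h)) (skip-distinct P j h)
             (prev-nb P j (m≤n⇒m≤1+n (s≤s⁻¹ h))) (next-nb P (suc j) h) fj-y
    ... | inj₁ y≡fj =
      ⊥-elim (path-deleted P chosen j (m≤n⇒m≤1+n (s≤s⁻¹ h)) (subst (λ v → s′ v ≡ true) y≡fj survives))
    ... | inj₂ y≡fj+2 with suc (suc j) <? suc (suc k)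
    ...   | yes j+2<K = ⊥-elim (path-deleted P chosen _ j+2<K (subst (λ v → s′ v ≡ true) y≡fj+2 survives))
    ...   | no  j+2≮K with refl ← ≤-antisym (s≤s⁻¹ (s≤s⁻¹ h)) (s≤s⁻¹ (s≤s⁻¹ (≮⇒≥ j+2≮K))) =
      k , f , P , chosen , sym y≡fj+2 , refl

    deleted-neighbour : ∀ {z} → s′ z ≢ true → s z ≡ true → adj y z ≡ true → ¬ ¬ DeletedInto y z
    deleted-neighbour {z} deleted alive-z yz not-into = deleted (from (newState z) (alive-z , not-on-path))
      where
      z-y : nb s z y ≡ true
      z-y = nb-flip {s} (survivor-alive survives) (nb-intro {s} alive-z yz)
      not-on-path : ¬ (∃[ v ] (T v × ∃[ k ] ∃[ p ] (MaxPath G s k p × first G p ≡ v ×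
                        ∃[ i ] (p (inject₁ {suc (suc k)} i) ≡ z))))
      not-on-path (v , chosen , k , p , mp , p0≡v , x , px≡z) =
        not-into (subst (DeletedInto y) fx≡z
          (neighbour-on-path (fromMaxPath mp) (subst T (sym p0≡v) chosen) (toℕ x) (FP.toℕ<n x)
                             (subst (λ u → nb s u y ≡ true) (sym fx≡z) z-y)))
        where
        fx≡z : p (clamp (suc (suc k)) (toℕ x)) ≡ z
        fx≡z = trans (cong p (trans (cong (clamp _) (sym (FP.toℕ-inject₁ x))) (clamp-toℕ-inverse _ (inject₁ x))))
                     px≡z

module Leaves {n : ℕ} (G : Graph n) where
  open Graph G
  open Counting {Fin n}
  open Neighbourhood G
  open Paths G

  ApplicantsDeg2 : State n → Set
  ApplicantsDeg2 s = ∀ v → s v ≡ true → side v ≡ true → deg G s v ≡ 2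

  isLeaf : State n → Fin n → Bool
  isLeaf s v = s v ∧ (deg G s v ≡ᵇ 1)

  isLeaf-intro : ∀ {s v} → s v ≡ true → deg G s v ≡ 1 → isLeaf s v ≡ true
  isLeaf-intro sv d = ∧-intro sv (Equivalence.to T-≡ (≡⇒≡ᵇ _ 1 d))

  isLeaf-sound : ∀ {s v} → isLeaf s v ≡ true → s v ≡ true × deg G s v ≡ 1
  isLeaf-sound {s} {v} h = ∧-trueˡ h , ≡ᵇ⇒≡ _ 1 (Equivalence.from T-≡ (∧-trueʳ {s v} h))

  leaves : State n → ℕ
  leaves s = count (isLeaf s) (allFin n)

  leaves-positive : ∀ {s} → LoopCond G s → 1 ≤ leaves s
  leaves-positive {s} (v , sv , _ , d) =
    unique-≤-count F._≟_ (allFin n) (v ∷ []) ([] ∷ []) (λ _ → ∈-allFin _) λ { (here refl) → isLeaf-intro sv d }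

  leaves-≤-n : ∀ s → leaves s ≤ n
  leaves-≤-n s = ≤-trans (length-filter (λ v → isLeaf s v ≟B true) (allFin n)) (≤-reflexive (length-tabulate id))

  -- FromLeaf s y v: v is a leaf starting a maximal path that ends at y.  Each
  -- leaf is related to at most one y, since its maximal path is unique.
  FromLeaf : State n → Fin n → Fin n → Set
  FromLeaf s y v = ∃[ k ] ∃[ f ] (MaxPathℕ s k f × f 0 ≡ v × f (suc (suc k)) ≡ y × deg G s v ≡ 1)

  FromLeaf-functional : ∀ {s y y′ v} → FromLeaf s y v → FromLeaf s y′ v → y ≡ y′
  FromLeaf-functional {s} (k , f , P , f0≡v , fK≡y , d) (_ , g , Q , g0≡v , gK≡y′ , _)
    with refl , f≗g ← leaf-path-unique P Q (trans f0≡v (sym g0≡v)) (trans (cong (deg G s) f0≡v) d) =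
    trans (sym fK≡y) (trans (f≗g _ ≤-refl) gK≡y′)

  -- Under the invariant every leaf starts a maximal path: a leaf lies in 𝒫,
  -- so its neighbour lies in 𝒜 and has degree 2.
  leaf-starts-path : ∀ {s y} → ApplicantsDeg2 s → s y ≡ true → deg G s y ≡ 1 →
                     ∃[ k ] ∃[ f ] (MaxPathℕ s k f × f 0 ≡ y)
  leaf-starts-path {s} {y} inv sy leaf
    with a , ya ← some-neighbour {s} (≤-reflexive (sym leaf))
    with side y in side-y | side a in side-a
  ... | true  | _     = ⊥-elim (<⇒≢ (n<1+n 1) (trans (sym leaf) (inv y sy side-y)))
  ... | false | false = ⊥-elim (bipartite y a (∧-trueʳ {s a} ya) (trans side-y (sym side-a)))
  ... | false | true  = leaf-path sy leaf a ya (inv a (∧-trueˡ ya) side-a)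

  module _ {s s′ : State n} {T : Fin n → Set} (R : RoundWith G s s′ T) (inv : ApplicantsDeg2 s) where
    open RoundWith R
    open Round G s s′ T R
    open DoubleCounting F._≟_ (isLeaf s) (FromLeaf s) FromLeaf-functional

    lost : Fin n → Fin n → Bool
    lost y u = nb s y u ∧ not (s′ u)

    lost-deleted-into : ∀ {y u} → s′ y ≡ true → lost y u ≡ true → ¬ ¬ DeletedInto y u
    lost-deleted-into {y} {u} sy h with s′ u in deleted | ∧-trueˡ h | ∧-trueʳ {nb s y u} h
    ... | false | yu | _ =
      deleted-neighbour sy (λ alive → false≢true (trans (sym deleted) alive)) (∧-trueˡ yu) (∧-trueʳ {s u} yu)

    deg-mono : ∀ y → deg G s′ y ≤ deg G s y
    deg-mono y = count-mono (λ u h → nb-intro {s} (survivor-alive (∧-trueˡ h)) (∧-trueʳ {s′ u} h)) (allFin n)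

    deg-≤-kept+lost : ∀ y → deg G s y ≤ deg G s′ y + count (lost y) (allFin n)
    deg-≤-kept+lost y = count-≤-+ kept-or-lost (allFin n)
      where
      kept-or-lost : ∀ u → nb s y u ≡ true → nb s′ y u ≡ true ⊎ lost y u ≡ true
      kept-or-lost u h with s′ u
      ... | true  = inj₁ (∧-trueʳ {s u} h)
      ... | false = inj₂ (∧-intro h refl)

    drop-lost : ∀ {y} → deg G s′ y < deg G s y → 1 ≤ count (lost y) (allFin n)
    drop-lost {y} drop with count (lost y) (allFin n) | deg-≤-kept+lost y
    ... | zero  | h = ⊥-elim (<⇒≱ drop (subst (deg G s y ≤_) (+-identityʳ _) h))
    ... | suc _ | _ = s≤s z≤n

    -- A surviving vertex of degree 2 keeps its degree: a lost neighbour would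
    -- make it the end of a maximal path, and ends have degree ≠ 2.
    deg2-kept : ∀ {y} → s′ y ≡ true → deg G s y ≡ 2 → deg G s′ y ≡ 2
    deg2-kept {y} sy d with deg G s′ y ≟ 2
    ... | yes d′ = d′
    ... | no d′≢2
      with u , _ , lu ← count-witness (allFin n) (drop-lost (≤∧≢⇒< (deg-mono y) (λ e → d′≢2 (trans e d)))) =
      ⊥-elim (lost-deleted-into sy lu λ (_ , _ , P , _ , fK≡y , _) →
                MaxPathℕ.finalEnd P (trans (cong (deg G s) fK≡y) d))

    inv-preserved : ApplicantsDeg2 s′
    inv-preserved v sv side-v = deg2-kept sv (inv v (survivor-alive sv) side-v)

    -- A surviving leaf does not stay a leaf: its maximal path is deleted from
    -- one end or the other, and then its only neighbour is gone.
    leaf-not-kept : ∀ {y} → s′ y ≡ true → deg G s y ≡ 1 → deg G s′ y ≢ 1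
    leaf-not-kept {y} sy leaf leaf′
      with k , f , P , f0≡y ← leaf-starts-path inv (survivor-alive sy) leaf
      with proj₁ (covered k (λ x → f (toℕ x)) (toMaxPath P) (inj₁ (trans (cong (deg G s) f0≡y) leaf)))
    ... | inj₁ (_ , chosen) = path-deleted P chosen 0 z<s (subst (λ v → s′ v ≡ true) (sym f0≡y) sy)
    ... | inj₂ (_ , chosen) = path-deleted (reverse P) (subst (λ i → T (f i)) (FP.toℕ-fromℕ (suc (suc k))) chosen)
                                (suc k) ≤-refl (subst (λ i → s′ (f i) ≡ true) (sym (m+n∸n≡m 1 k)) f1-alive)
      where
      f1-alive : s′ (f 1) ≡ true
      f1-alive with u , yu′ ← some-neighbour {s′} (≤-reflexive (sym leaf′)) =
        subst (λ v → s′ v ≡ true)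
          (deg1-unique {s} leaf (nb-intro {s} (survivor-alive (∧-trueˡ yu′)) (∧-trueʳ {s′ u} yu′))
                                (subst (λ v → nb s v (f 1) ≡ true) f0≡y (next-nb P 0 z<s)))
          (∧-trueˡ yu′)

    two-lost : ∀ {y} → deg G s′ y ≡ 1 → 3 ≤ deg G s y → 2 ≤ count (lost y) (allFin n)
    two-lost {y} leaf′ 3≤deg =
      s≤s⁻¹ (≤-trans 3≤deg (subst (λ d → deg G s y ≤ d + count (lost y) (allFin n)) leaf′ (deg-≤-kept+lost y)))

    -- Two distinct lost neighbours of a survivor y yield two leaves related to
    -- y: the chosen starts of the paths running into y.  They differ because a
    -- leaf's maximal path is unique, and the two paths end differently.
    two-sources : ∀ {y z₁ z₂} → s′ y ≡ true → z₁ ≢ z₂ → lost y z₁ ≡ true → lost y z₂ ≡ true →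
                  ¬ ¬ TwoWitnesses y
    two-sources {y} {z₁} {z₂} sy z₁≢z₂ l₁ l₂ not-two =
      lost-deleted-into sy l₁ λ into₁ → lost-deleted-into sy l₂ λ into₂ → not-two (sources into₁ into₂)
      where
      sources : DeletedInto y z₁ → DeletedInto y z₂ → TwoWitnesses y
      sources (k₁ , f₁ , P₁ , T₁ , f₁-end , f₁-last) (k₂ , f₂ , P₂ , T₂ , f₂-end , f₂-last) =
        f₁ 0 , f₂ 0 , distinct , (k₁ , f₁ , P₁ , refl , f₁-end , leaf₁) , (k₂ , f₂ , P₂ , refl , f₂-end , leaf₂) ,
        isLeaf-intro (MaxPathℕ.alive P₁ 0 z≤n) leaf₁ , isLeaf-intro (MaxPathℕ.alive P₂ 0 z≤n) leaf₂
        where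
        leaf₁ = proj₁ (proj₂ (chosenOk (f₁ 0) T₁))
        leaf₂ = proj₁ (proj₂ (chosenOk (f₂ 0) T₂))
        distinct : f₁ 0 ≢ f₂ 0
        distinct e with refl , f₁≗f₂ ← leaf-path-unique P₁ P₂ e leaf₁ =
          z₁≢z₂ (trans (sym f₁-last) (trans (f₁≗f₂ (suc k₁) (n≤1+n _)) f₂-last))

    -- Every leaf after the round has two leaves before the round related to
    -- it: it was neither a leaf (leaf-not-kept) nor of degree 2 (deg2-kept).
    new-leaf-sources : ∀ {y} → isLeaf s′ y ≡ true → ¬ ¬ TwoWitnesses y
    new-leaf-sources {y} h with isLeaf-sound {s′} h
    ... | sy , leaf′ with deg G s y in d
    ... | zero              = ⊥-elim (1+n≰n (subst₂ _≤_ leaf′ d (deg-mono y)))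
    ... | suc zero          = ⊥-elim (leaf-not-kept sy d leaf′)
    ... | suc (suc zero)    = ⊥-elim (<⇒≢ (n<1+n 1) (trans (sym leaf′) (deg2-kept sy d)))
    ... | suc (suc (suc _))
      with z₁ , z₂ , z₁≢z₂ , l₁ , l₂ ← count-two-witnesses (allFin n) (Unique.allFin⁺ n)
                                         (two-lost leaf′ (subst (3 ≤_) (sym d) (s≤s (s≤s (s≤s z≤n))))) =
      two-sources sy z₁≢z₂ l₁ l₂

    -- Double counting the sources of the new leaves: each round at least
    -- halves the number of leaves.
    halving : 2 * leaves s′ ≤ leaves s
    halving = decidable-stable (_ ≤? _) λ not-halved →
      All.sequenceM 0ℓ ¬¬-Monad
        (All.tabulate (λ y∈ → new-leaf-sources (proj₂ (∈-filter⁻ leaf? {xs = allFin n} y∈))))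
        λ ws → not-halved (subst (_≤ leaves s) (cong (leaves s′ +_) (sym (+-identityʳ (leaves s′))))
                             (double-count (Unique.filter⁺ leaf? (Unique.allFin⁺ n)) ws (allFin n) ∈-allFin))
      where
      leaf? = λ v → isLeaf s′ v ≟B true

  rounds-bound : ∀ {s} k → Runs G s (suc k) → ApplicantsDeg2 s → 2 ^ k ≤ leaves s
  rounds-bound zero    (step loop _ _) _ = leaves-positive loop
  rounds-bound (suc k) (step _ (_ , R) runs) inv =
    ≤-trans (*-monoʳ-≤ 2 (rounds-bound k runs (inv-preserved R inv))) (halving R inv)

exponent-≤-log : ∀ {k m} → 2 ^ k ≤ m → k ≤ ⌊log₂ m ⌋
exponent-≤-log {k} h = subst (_≤ _) (⌊log₂[2^n]⌋≡n k) (⌊log₂⌋-mono-≤ h)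

-- Every run from the initial graph has at most 1 + ⌊log₂ n⌋ rounds, which
-- is at most 2 ⌊log₂ n⌋ once n ≥ 2.
lemma1 : ∃[ c ] ∃[ N ] (∀ (n : ℕ) → N ≤ n → (G : Graph n) → ∀ (k : ℕ) →
           Runs G allAlive k → k ≤ c * ⌊log₂ n ⌋)
lemma1 = 2 , 2 , bound
  where
  bound : ∀ n → 2 ≤ n → (G : Graph n) → ∀ k → Runs G allAlive k → k ≤ 2 * ⌊log₂ n ⌋
  bound n _   G zero    _    = z≤n
  bound n 2≤n G (suc k) runs = begin
    1 + k                 ≤⟨ +-mono-≤ (exponent-≤-log {1} 2≤n) k≤log ⟩
    ⌊log₂ n ⌋ + ⌊log₂ n ⌋ ≡⟨ cong (⌊log₂ n ⌋ +_) (sym (+-identityʳ _)) ⟩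
    2 * ⌊log₂ n ⌋         ∎
    where
    open ≤-Reasoning
    open Leaves G
    -- the initial graph satisfies the invariant, and 2^k ≤ leaves ≤ n
    k≤log : k ≤ ⌊log₂ n ⌋
    k≤log = exponent-≤-log (≤-trans (rounds-bound k runs (λ v _ → Graph.degA G v)) (leaves-≤-n allAlive))
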